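{- Let $\mathbb{F}$ be a field, let $f\in\mathbb{F}[x_1,\ldots,x_n]$ be a nonzero polynomial, and let $\prec$ be any monomial ordering on $\mathbb{F}[\vec{x}]$. Let $\vec{x}^{\vec{i}}$ be the largest monomial (with respect to $\prec$) having nonzero coefficient in $f$. Then $|\vec{i}|_0\le\log_2|\partial(f)|$.
   Context: $|\vec{i}|_0$ is the number of nonzero coordinates of $\vec{i}$. A monomial ordering is a total order $\prec$ on monomials with $1\preceq\vec{x}^{\vec{i}}$ for all $\vec{i}$ and $\vec{x}^{\vec{i}}\prec\vec{x}^{\vec{j}}\Rightarrow\vec{x}^{\vec{i}+\vec{k}}\prec\vec{x}^{\vec{j}+\vec{k}}$. Hasse derivatives: $\partial_{x_\ell^k}(f)$ is the coefficient of $y^k$ in $f(x_1,\ldots,x_\ell+y,\ldots,x_n)$, $\partial_{\vec{x}^{\vec{j}}}=\partial_{x_1^{j_1}}\cdots\partial_{x_n^{j_n}}$, and $|\partial(f)|=\dim_{\mathbb{F}}\operatorname{span}\{\partial_{\vec{x}^{\vec{j}}}(f):\vec{j}\in\mathbb{N}^n\}$. -}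

module Defs where

open import Level using (Level; _⊔_; suc)
open import Algebra.Bundles using (CommutativeRing)
open import Data.Nat as ℕ using (ℕ; zero)
open import Data.Nat.Combinatorics using (_C_)
open import Data.Fin using (Fin)
open import Data.Vec using (Vec; lookup; updateAt; zipWith; replicate)
open import Data.List using (List; foldr; allFin)
open import Data.Product using (_×_; _,_; Σ; ∃)
open import Data.Sum using (_⊎_)
open import Relation.Nullary using (¬_)
open import Relation.Binary.PropositionalEquality using (_≡_)
open import Relation.Binary.Structures using (IsStrictTotalOrder)

record Field (c ℓ : Level) : Set (Level.suc (c ⊔ ℓ)) where
  field
    commutativeRing : CommutativeRing c ℓ
  open CommutativeRing commutativeRing public
  field
    0≉1     : ¬ (0# ≈ 1#)
    inverse : ∀ x → ¬ (x ≈ 0#) → Σ Carrier (λ y → (x * y) ≈ 1#)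

Exp : ℕ → Set
Exp n = Vec ℕ n

support : ∀ {n} → Exp n → ℕ
support Vec.[] = 0
support (zero Vec.∷ v) = support v
support (ℕ.suc _ Vec.∷ v) = ℕ.suc (support v)

record MonomialOrder (n : ℕ) : Set₁ where
  field
    _≺_            : Exp n → Exp n → Set
    isStrictTotal  : IsStrictTotalOrder _≡_ _≺_
    one-least      : ∀ i → replicate n 0 ≡ i ⊎ replicate n 0 ≺ i
    compatible     : ∀ i j k → i ≺ j → zipWith ℕ._+_ i k ≺ zipWith ℕ._+_ j k

  _⪯_ : Exp n → Exp n → Set
  i ⪯ j = i ≡ j ⊎ i ≺ j

module FieldDefs {c ℓ : Level} (F : Field c ℓ) where
  open Field F

  _·_ : ℕ → Carrier → Carrier
  zero · a = 0#
  ℕ.suc m · a = a + (m · a)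

  record Poly (n : ℕ) : Set (c ⊔ ℓ) where
    field
      coeff  : Exp n → Carrier
      bound  : ℕ
      finite : ∀ i → (∃ λ t → bound ℕ.< lookup i t) → coeff i ≈ 0#
  open Poly public

  -- Coefficient functions (ℕ^n → F); all derivatives of a polynomial are
  -- again polynomials, so we work with coefficient functions below.
  Coeffs : ℕ → Set c
  Coeffs n = Exp n → Carrier

  -- Hasse derivative ∂_{x_ℓ^k}: the coefficient of y^k in f(x_1,..,x_ℓ+y,..,x_n).
  -- Expanding (x_ℓ+y)^{a} binomially, the coefficient of x^i in it is
  -- C(i_ℓ+k, k) · f_{i + k e_ℓ}.
  hasse1 : ∀ {n} → Fin n → ℕ → Coeffs n → Coeffs n
  hasse1 t k g i = ((lookup i t ℕ.+ k) C k) · g (updateAt i t (ℕ._+ k))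

  hasse : ∀ {n} → Exp n → Coeffs n → Coeffs n
  hasse {n} j g = foldr (λ t h → hasse1 t (lookup j t) h) g (allFin n)

  -- An element of span{∂_{x^j} f : j ∈ ℕ^n}: a finite linear combination
  -- Σ a_r ∂_{x^{j_r}} f, given by the list of pairs (a_r, j_r).
  combo : ∀ {n} → Coeffs n → List (Carrier × Exp n) → Coeffs n
  combo g ts i = foldr (λ { (a , j) s → (a * hasse j g i) + s }) 0# ts

  sumFin : ∀ m → (Fin m → Carrier) → Carrier
  sumFin zero h = 0#
  sumFin (ℕ.suc m) h = h Fin.zero + sumFin m (λ r → h (Fin.suc r))

  LinearlyIndependent : ∀ {n m} → (Fin m → Coeffs n) → Set (c ⊔ ℓ)
  LinearlyIndependent {n} {m} g =
    ∀ (a : Fin m → Carrier) →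
      (∀ i → sumFin m (λ r → a r * g r i) ≈ 0#) → ∀ r → a r ≈ 0#

  -- m ≤ |∂(f)| = dim span{∂_{x^j} f}: the span contains m linearly
  -- independent elements.
  _≤dimPartials_ : ∀ {n} → ℕ → Poly n → Set (c ⊔ ℓ)
  _≤dimPartials_ {n} m f =
    Σ (Fin m → List (Carrier × Exp n)) λ ts →
      LinearlyIndependent (λ r → combo (coeff f) (ts r))

  IsLeadingMonomial : ∀ {n} → MonomialOrder n → Poly n → Exp n → Set ℓ
  IsLeadingMonomial O f i =
    ¬ (coeff f i ≈ 0#) × (∀ i' → ¬ (coeff f i' ≈ 0#) → i' ⪯ i)
    where open MonomialOrder O

-- Send every nonzero coordinate of the leading exponent i wholly into either l
-- or j; for each of the 2^{|i|_0} choices, i = l + j and every binomial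
-- C(l_t + j_t, j_t) is 1, so the coefficient of x^l in ∂_{x^j} f is f_i ≠ 0.
-- For x^k ≻ x^l the coefficient of x^k is a multiple of f_{k+j}, and x^{k+j} ≻ x^i
-- by compatibility of ≺, so it vanishes.  The derivatives thus have pairwise
-- distinct leading monomials x^l, and Gaussian elimination from the largest one
-- downwards shows they are linearly independent.
module Submission where

open import Defs
open import Level using (Level)
open import Data.Nat using (ℕ; _^_)
open import Data.Product using (∃)
open import Relation.Nullary using (¬_)

open import Data.Nat as ℕ using (zero; suc)
import Data.Nat.Properties as ℕ
open import Data.Nat.Combinatorics using (_C_; nCn≡1)
open import Data.Fin as Fin using (Fin; punchIn; punchOut; remQuot; combine)
open import Data.Fin.Properties using (combine-remQuot; punchIn-injective; punchInᵢ≢i; punchIn-punchOut)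
open import Data.Vec using ([]; _∷_; zipWith; updateAt; lookup)
open import Data.Vec.Properties using (∷-injective)
import Data.List as List
open import Data.List.Properties using (map-tabulate)
open import Data.Product using (Σ; _,_; proj₁; proj₂; _×_; uncurry)
import Data.Product as Product
open import Data.Sum using (_⊎_; inj₁; inj₂)
open import Data.Empty using (⊥-elim)
open import Function using (_∘_; id)
open import Function.Definitions using (Injective)
open import Relation.Nullary using (yes; no)
open import Relation.Nullary.Negation using (¬¬-map)
open import Relation.Binary.PropositionalEquality using (_≡_; refl; cong; cong₂; subst)
import Relation.Binary.PropositionalEquality as ≡
open import Relation.Binary.Definitions using (tri<; tri≈; tri>)
open import Relation.Binary.Structures using (IsStrictTotalOrder)

remQuot-injective : ∀ {m} k {r r' : Fin (m ℕ.* k)} → remQuot {m} k r ≡ remQuot k r' → r ≡ r'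
remQuot-injective {m} k {r} {r'} eq =
  ≡.trans (≡.sym (combine-remQuot {m} k r))
          (≡.trans (cong (uncurry combine) eq) (combine-remQuot {m} k r'))

∀-punchIn : ∀ {p m} (P : Fin (suc m) → Set p) r₀ → P r₀ → (∀ s → P (punchIn r₀ s)) → ∀ r → P r
∀-punchIn P r₀ Pr₀ Ps r with r₀ Fin.≟ r
... | yes refl = Pr₀
... | no r₀≢r = subst P (punchIn-punchOut r₀≢r) (Ps (punchOut r₀≢r))

module _ {a} {A : Set a} {_≺_ : A → A → Set} (sto : IsStrictTotalOrder _≡_ _≺_) where
  open IsStrictTotalOrder sto using (compare) renaming (trans to ≺-trans)

  argmax : ∀ m (L : Fin (suc m) → A) → Σ (Fin (suc m)) λ r₀ → ∀ r → L r ≡ L r₀ ⊎ L r ≺ L r₀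
  argmax zero L = Fin.zero , λ { Fin.zero → inj₁ refl }
  argmax (suc m) L with argmax m (L ∘ Fin.suc)
  ... | r₁ , max₁ with compare (L Fin.zero) (L (Fin.suc r₁))
  ...   | tri< lt _ _ = Fin.suc r₁ , λ { Fin.zero → inj₂ lt ; (Fin.suc r) → max₁ r }
  ...   | tri≈ _ eq _ = Fin.suc r₁ , λ { Fin.zero → inj₁ eq ; (Fin.suc r) → max₁ r }
  ...   | tri> _ _ gt = Fin.zero , λ { Fin.zero → inj₁ refl ; (Fin.suc r) → below (max₁ r) }
    where
    below : ∀ {x} → x ≡ L (Fin.suc r₁) ⊎ x ≺ L (Fin.suc r₁) → x ≡ L Fin.zero ⊎ x ≺ L Fin.zero
    below (inj₁ refl) = inj₂ gt
    below (inj₂ lt) = inj₂ (≺-trans lt gt)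

binomialProduct : ∀ {n} → Exp n → Exp n → ℕ
binomialProduct [] [] = 1
binomialProduct (x ∷ k) (y ∷ j) = ((x ℕ.+ y) C y) ℕ.* binomialProduct k j

consSplit : ∀ {n} → Fin 2 → ℕ → Exp n × Exp n → Exp (suc n) × Exp (suc n)
consSplit Fin.zero a (l , j) = a ∷ l , 0 ∷ j
consSplit (Fin.suc Fin.zero) a (l , j) = 0 ∷ l , a ∷ j

coordinateSplit : ∀ {n} (i : Exp n) → Fin (2 ^ support i) → Exp n × Exp n
coordinateSplit [] _ = [] , []
coordinateSplit (zero ∷ i) r = Product.map (0 ∷_) (0 ∷_) (coordinateSplit i r)
coordinateSplit (suc a ∷ i) r =
  let (b , s) = remQuot (2 ^ support i) r in consSplit b (suc a) (coordinateSplit i s)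

consSplit-sum : ∀ {n} b a (p : Exp n × Exp n) →
  uncurry (zipWith ℕ._+_) (consSplit b a p) ≡ a ∷ uncurry (zipWith ℕ._+_) p
consSplit-sum Fin.zero a p = cong (_∷ _) (ℕ.+-identityʳ a)
consSplit-sum (Fin.suc Fin.zero) a p = refl

coordinateSplit-sum : ∀ {n} (i : Exp n) r → uncurry (zipWith ℕ._+_) (coordinateSplit i r) ≡ i
coordinateSplit-sum [] r = refl
coordinateSplit-sum (zero ∷ i) r = cong (0 ∷_) (coordinateSplit-sum i r)
coordinateSplit-sum (suc a ∷ i) r =
  let (b , s) = remQuot (2 ^ support i) r in
  ≡.trans (consSplit-sum b (suc a) (coordinateSplit i s)) (cong (suc a ∷_) (coordinateSplit-sum i s))

consSplit-binomialProduct : ∀ {n} b a (p : Exp n × Exp n) →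
  uncurry binomialProduct (consSplit b a p) ≡ uncurry binomialProduct p
consSplit-binomialProduct Fin.zero a p = ℕ.+-identityʳ _
consSplit-binomialProduct (Fin.suc Fin.zero) a p = ≡.trans (cong (ℕ._* _) (nCn≡1 a)) (ℕ.+-identityʳ _)

coordinateSplit-binomialProduct : ∀ {n} (i : Exp n) r → uncurry binomialProduct (coordinateSplit i r) ≡ 1
coordinateSplit-binomialProduct [] r = refl
coordinateSplit-binomialProduct (zero ∷ i) r = ≡.trans (ℕ.+-identityʳ _) (coordinateSplit-binomialProduct i r)
coordinateSplit-binomialProduct (suc a ∷ i) r =
  let (b , s) = remQuot (2 ^ support i) r in
  ≡.trans (consSplit-binomialProduct b (suc a) (coordinateSplit i s)) (coordinateSplit-binomialProduct i s)

consSplit-injective : ∀ {n} b b' a (p p' : Exp n × Exp n) →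
  proj₁ (consSplit b (suc a) p) ≡ proj₁ (consSplit b' (suc a) p') → b ≡ b' × proj₁ p ≡ proj₁ p'
consSplit-injective Fin.zero Fin.zero a p p' eq = refl , proj₂ (∷-injective eq)
consSplit-injective (Fin.suc Fin.zero) (Fin.suc Fin.zero) a p p' eq = refl , proj₂ (∷-injective eq)
consSplit-injective Fin.zero (Fin.suc Fin.zero) a p p' eq with proj₁ (∷-injective eq)
... | ()
consSplit-injective (Fin.suc Fin.zero) Fin.zero a p p' eq with proj₁ (∷-injective eq)
... | ()

coordinateSplit-injective : ∀ {n} (i : Exp n) → Injective _≡_ _≡_ (proj₁ ∘ coordinateSplit i)
coordinateSplit-injective [] {Fin.zero} {Fin.zero} _ = refl
coordinateSplit-injective (zero ∷ i) eq = coordinateSplit-injective i (proj₂ (∷-injective eq))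
coordinateSplit-injective (suc a ∷ i) {r} {r'} eq =
  let (b , s) = remQuot (2 ^ support i) r
      (b' , s') = remQuot (2 ^ support i) r'
      (b≡b' , l≡l') = consSplit-injective b b' a (coordinateSplit i s) (coordinateSplit i s') eq
  in remQuot-injective (2 ^ support i) (cong₂ _,_ b≡b' (coordinateSplit-injective i l≡l'))

module _ {c ℓ : Level} (F : Field c ℓ) where
  open Field F hiding (refl)
  open FieldDefs F
  open import Algebra.Properties.Ring ring using (+-inverseˡ-unique; -‿distribˡ-*; -‿distribʳ-*)
  open import Algebra.Properties.Semiring.Sum semiring
    using (sum; sum-cong-≋; sum-remove; ∑-distrib-+; *-distribʳ-sum; sum-replicate-zero)
  open import Algebra.Properties.Monoid.Mult +-monoid using (×-congʳ; ×-assocˡ) renaming (_×_ to _·ᴹ_)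
  open import Relation.Binary.Reasoning.Setoid setoid

  sumFin≡sum : ∀ m (h : Fin m → Carrier) → sumFin m h ≡ sum h
  sumFin≡sum zero h = refl
  sumFin≡sum (suc m) h = cong (h Fin.zero +_) (sumFin≡sum m (h ∘ Fin.suc))

  ·≡·ᴹ : ∀ m x → m · x ≡ m ·ᴹ x
  ·≡·ᴹ zero x = refl
  ·≡·ᴹ (suc m) x = cong (x +_) (·≡·ᴹ m x)

  ·-assoc : ∀ m m' x → m · (m' · x) ≈ (m ℕ.* m') · x
  ·-assoc m m' x = begin
    m · (m' · x)    ≡⟨ ≡.trans (·≡·ᴹ m _) (cong (m ·ᴹ_) (·≡·ᴹ m' x)) ⟩
    m ·ᴹ (m' ·ᴹ x)  ≈⟨ ×-assocˡ x m m' ⟩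
    (m ℕ.* m') ·ᴹ x  ≡⟨ ·≡·ᴹ (m ℕ.* m') x ⟨
    (m ℕ.* m') · x  ∎

  ·-zeroʳ : ∀ m {x} → x ≈ 0# → m · x ≈ 0#
  ·-zeroʳ zero _ = Field.refl F
  ·-zeroʳ (suc m) x≈0 = trans (+-cong x≈0 (·-zeroʳ m x≈0)) (+-identityˡ 0#)

  ·-identityˡ : ∀ x → 1 · x ≈ x
  ·-identityˡ = +-identityʳ

  x*d+s≈0⇒x≈s*-y : ∀ {x d s y} → x * d + s ≈ 0# → d * y ≈ 1# → x ≈ s * - y
  x*d+s≈0⇒x≈s*-y {x} {d} {s} {y} x*d+s≈0 d*y≈1 = begin
    x             ≈⟨ *-identityʳ x ⟨
    x * 1#        ≈⟨ *-congˡ d*y≈1 ⟨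
    x * (d * y)   ≈⟨ *-assoc x d y ⟨
    (x * d) * y   ≈⟨ *-congʳ (+-inverseˡ-unique (x * d) s x*d+s≈0) ⟩
    (- s) * y     ≈⟨ -‿distribˡ-* s y ⟨
    - (s * y)     ≈⟨ -‿distribʳ-* s y ⟩
    s * - y       ∎

  sum-*-+-* : ∀ m (a u e : Fin m → Carrier) w →
    sum (λ s → a s * (u s + e s * w)) ≈ sum (λ s → a s * u s) + sum (λ s → a s * e s) * w
  sum-*-+-* m a u e w = begin
    sum (λ s → a s * (u s + e s * w))
      ≈⟨ sum-cong-≋ (λ s → trans (distribˡ (a s) _ _) (+-congˡ (sym (*-assoc (a s) (e s) w)))) ⟩
    sum (λ s → a s * u s + (a s * e s) * w)
      ≈⟨ ∑-distrib-+ (λ s → a s * u s) (λ s → (a s * e s) * w) ⟩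
    sum (λ s → a s * u s) + sum (λ s → (a s * e s) * w)
      ≈⟨ +-congˡ (*-distribʳ-sum w (λ s → a s * e s)) ⟨
    sum (λ s → a s * u s) + sum (λ s → a s * e s) * w
      ∎

  -- With y the inverse of the pivot g r₀ l₀, this clears the coefficient at l₀:
  -- g (punchIn r₀ s) − (g (punchIn r₀ s) l₀ / g r₀ l₀) · g r₀.
  eliminate : ∀ {n m} → (Fin (suc m) → Coeffs n) → Fin (suc m) → Exp n → Carrier → Fin m → Coeffs n
  eliminate g r₀ l₀ y s k = g (punchIn r₀ s) k + g (punchIn r₀ s) l₀ * (- y * g r₀ k)

  eliminate-trivial : ∀ {n m} (g : Fin (suc m) → Coeffs n) r₀ l₀ y s →
    g (punchIn r₀ s) l₀ ≈ 0# → ∀ k → eliminate g r₀ l₀ y s k ≈ g (punchIn r₀ s) k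
  eliminate-trivial g r₀ l₀ y s e≈0 k = trans (+-congˡ (trans (*-congʳ e≈0) (zeroˡ _))) (+-identityʳ _)

  module _ {n m} (a : Fin (suc m) → Carrier) (g : Fin (suc m) → Coeffs n) (r₀ : Fin (suc m)) (l₀ : Exp n) where
    private
      S : Exp n → Carrier
      S k = sum (λ s → a (punchIn r₀ s) * g (punchIn r₀ s) k)

    pivot-coefficient : ∀ {y} → g r₀ l₀ * y ≈ 1# → sum (λ r → a r * g r l₀) ≈ 0# → a r₀ ≈ S l₀ * - y
    pivot-coefficient d*y≈1 Σ≈0 =
      x*d+s≈0⇒x≈s*-y (trans (sym (sum-remove {i = r₀} (λ r → a r * g r l₀))) Σ≈0) d*y≈1

    eliminate-combination : ∀ {y} → g r₀ l₀ * y ≈ 1# → (∀ k → sum (λ r → a r * g r k) ≈ 0#) →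
      ∀ k → sum (λ s → a (punchIn r₀ s) * eliminate g r₀ l₀ y s k) ≈ 0#
    eliminate-combination {y} d*y≈1 Σ≈0 k = begin
      sum (λ s → a (punchIn r₀ s) * eliminate g r₀ l₀ y s k)
        ≈⟨ sum-*-+-* m (a ∘ punchIn r₀) (λ s → g (punchIn r₀ s) k)
                       (λ s → g (punchIn r₀ s) l₀) (- y * g r₀ k) ⟩
      S k + S l₀ * (- y * g r₀ k)  ≈⟨ +-congˡ (*-assoc _ _ _) ⟨
      S k + (S l₀ * - y) * g r₀ k  ≈⟨ +-congˡ (*-congʳ (pivot-coefficient d*y≈1 (Σ≈0 l₀))) ⟨
      S k + a r₀ * g r₀ k          ≈⟨ +-comm _ _ ⟩
      a r₀ * g r₀ k + S k          ≈⟨ sum-remove {i = r₀} (λ r → a r * g r k) ⟨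
      sum (λ r → a r * g r k)      ≈⟨ Σ≈0 k ⟩
      0#                           ∎

  hasseAlong : ∀ {n} → Exp n → List.List (Fin n) → Coeffs n → Coeffs n
  hasseAlong j ts g = List.foldr (λ t h → hasse1 t (lookup j t) h) g ts

  hasseAlong-suc : ∀ {n} (j : Exp n) y x (g : Coeffs (suc n)) ts k →
    hasseAlong (y ∷ j) (List.map Fin.suc ts) g (x ∷ k) ≡ hasseAlong j ts (λ k' → g (x ∷ k')) k
  hasseAlong-suc j y x g List.[] k = refl
  hasseAlong-suc j y x g (t List.∷ ts) k =
    cong (((lookup k t ℕ.+ lookup j t) C lookup j t) ·_)
         (hasseAlong-suc j y x g ts (updateAt k t (ℕ._+ lookup j t)))

  hasse-coeff : ∀ {n} (j k : Exp n) (g : Coeffs n) →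
    hasse j g k ≈ binomialProduct k j · g (zipWith ℕ._+_ k j)
  hasse-coeff [] [] g = sym (·-identityˡ _)
  hasse-coeff {suc n} (y ∷ j) (x ∷ k) g = begin
    hasse (y ∷ j) g (x ∷ k)
      ≡⟨⟩
    ((x ℕ.+ y) C y) · hasseAlong (y ∷ j) (List.tabulate Fin.suc) g (x ℕ.+ y ∷ k)
      ≡⟨ cong (λ ts → ((x ℕ.+ y) C y) · hasseAlong (y ∷ j) ts g (x ℕ.+ y ∷ k))
              (map-tabulate id Fin.suc) ⟨
    ((x ℕ.+ y) C y) · hasseAlong (y ∷ j) (List.map Fin.suc (List.allFin n)) g (x ℕ.+ y ∷ k)
      ≡⟨ cong (((x ℕ.+ y) C y) ·_) (hasseAlong-suc j y (x ℕ.+ y) g (List.allFin n) k) ⟩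
    ((x ℕ.+ y) C y) · hasse j (λ k' → g (x ℕ.+ y ∷ k')) k
      ≈⟨ ·-congʳ ((x ℕ.+ y) C y) (hasse-coeff j k (λ k' → g (x ℕ.+ y ∷ k'))) ⟩
    ((x ℕ.+ y) C y) · (binomialProduct k j · g (zipWith ℕ._+_ (x ∷ k) (y ∷ j)))
      ≈⟨ ·-assoc ((x ℕ.+ y) C y) (binomialProduct k j) _ ⟩
    binomialProduct (x ∷ k) (y ∷ j) · g (zipWith ℕ._+_ (x ∷ k) (y ∷ j))
      ∎
    where
    ·-congʳ : ∀ m {u v} → u ≈ v → m · u ≈ m · v
    ·-congʳ m {u} {v} u≈v = begin
      m · u  ≡⟨ ·≡·ᴹ m u ⟩
      m ·ᴹ u ≈⟨ ×-congʳ m u≈v ⟩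
      m ·ᴹ v ≡⟨ ·≡·ᴹ m v ⟨
      m · v  ∎

  module LeadingExponents {n} {_≺_ : Exp n → Exp n → Set} (sto : IsStrictTotalOrder _≡_ _≺_) where
    -- Equality in F is not decidable, so vanishing above the leading exponent
    -- is only available up to double negation.
    LeadsAt : Coeffs n → Exp n → Set ℓ
    LeadsAt g l = ¬ (g l ≈ 0#) × (∀ k → l ≺ k → ¬ ¬ (g k ≈ 0#))

    LeadsAt-resp : ∀ {g h l} → ¬ ¬ (∀ k → h k ≈ g k) → LeadsAt g l → LeadsAt h l
    LeadsAt-resp ¬¬h≈g (gl≉0 , above) =
        (λ hl≈0 → ¬¬h≈g λ h≈g → gl≉0 (trans (sym (h≈g _)) hl≈0))
      , (λ k l≺k hk≉0 → ¬¬h≈g λ h≈g → above k l≺k λ gk≈0 → hk≉0 (trans (h≈g k) gk≈0))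

    triangular⇒linearlyIndependent : ∀ m (g : Fin m → Coeffs n) (lead : Fin m → Exp n) →
      Injective _≡_ _≡_ lead → (∀ r → LeadsAt (g r) (lead r)) → LinearlyIndependent g
    triangular⇒linearlyIndependent zero g lead _ _ a _ ()
    triangular⇒linearlyIndependent (suc m) g lead lead-inj leads a Σag≈0 =
      ∀-punchIn (λ r → a r ≈ 0#) r₀ ar₀≈0 a∘p≈0
      where
      r₀ = proj₁ (argmax sto m lead)
      p = punchIn r₀

      below-r₀ : ∀ s → lead (p s) ≺ lead r₀
      below-r₀ s with proj₂ (argmax sto m lead) (p s)
      ... | inj₁ eq = ⊥-elim (punchInᵢ≢i r₀ s (lead-inj eq))
      ... | inj₂ lt = lt

      y = proj₁ (inverse (g r₀ (lead r₀)) (proj₁ (leads r₀)))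
      d*y≈1 = proj₂ (inverse (g r₀ (lead r₀)) (proj₁ (leads r₀)))

      Σag≈0' : ∀ k → sum (λ r → a r * g r k) ≈ 0#
      Σag≈0' k = trans (reflexive (≡.sym (sumFin≡sum (suc m) (λ r → a r * g r k)))) (Σag≈0 k)

      -- The coefficients g (p s) (lead r₀) vanish, though only up to ¬¬, so
      -- elimination does not change the leading data of the remaining family.
      leads' : ∀ s → LeadsAt (eliminate g r₀ (lead r₀) y s) (lead (p s))
      leads' s = LeadsAt-resp
        (¬¬-map (eliminate-trivial g r₀ (lead r₀) y s) (proj₂ (leads (p s)) (lead r₀) (below-r₀ s)))
        (leads (p s))

      a∘p≈0 : ∀ s → a (p s) ≈ 0#
      a∘p≈0 = triangular⇒linearlyIndependent m (eliminate g r₀ (lead r₀) y) (lead ∘ p)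
        (punchIn-injective r₀ _ _ ∘ lead-inj) leads' (a ∘ p)
        (λ k → trans (reflexive (sumFin≡sum m (λ s → a (p s) * eliminate g r₀ (lead r₀) y s k)))
                     (eliminate-combination a g r₀ (lead r₀) d*y≈1 Σag≈0' k))

      ar₀≈0 : a r₀ ≈ 0#
      ar₀≈0 = begin
        a r₀
          ≈⟨ pivot-coefficient a g r₀ (lead r₀) d*y≈1 (Σag≈0' (lead r₀)) ⟩
        sum (λ s → a (p s) * g (p s) (lead r₀)) * - y
          ≈⟨ *-congʳ (sum-cong-≋ {m} λ s → trans (*-congʳ (a∘p≈0 s)) (zeroˡ _)) ⟩
        sum {m} (λ _ → 0#) * - y
          ≈⟨ *-congʳ (sum-replicate-zero m) ⟩
        0# * - y
          ≈⟨ zeroˡ _ ⟩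
        0#
          ∎

  module _ {n} (O : MonomialOrder n) where
    open MonomialOrder O
    open IsStrictTotalOrder isStrictTotal using (irrefl) renaming (trans to ≺-trans)
    open LeadingExponents isStrictTotal

    above-leading : ∀ {f i k} → IsLeadingMonomial O f i → i ≺ k → ¬ ¬ (coeff f k ≈ 0#)
    above-leading (_ , maximal) i≺k fk≉0 with maximal _ fk≉0
    ... | inj₁ k≡i = irrefl (≡.sym k≡i) i≺k
    ... | inj₂ k≺i = irrefl refl (≺-trans i≺k k≺i)

    hasse-leadsAt : ∀ {f i} l j → IsLeadingMonomial O f i →
      zipWith ℕ._+_ l j ≡ i → binomialProduct l j ≡ 1 → LeadsAt (hasse j (coeff f)) l
    hasse-leadsAt {f} {i} l j leading@(fi≉0 , _) l+j≡i binom≡1 = at-l , above-l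
      where
      at-l : ¬ (hasse j (coeff f) l ≈ 0#)
      at-l ∂f≈0 = fi≉0 (begin
        coeff f i                                        ≈⟨ ·-identityˡ _ ⟨
        1 · coeff f i                                    ≡⟨ cong₂ (λ b k → b · coeff f k) binom≡1 l+j≡i ⟨
        binomialProduct l j · coeff f (zipWith ℕ._+_ l j) ≈⟨ hasse-coeff j l (coeff f) ⟨
        hasse j (coeff f) l                              ≈⟨ ∂f≈0 ⟩
        0#                                               ∎)
      above-l : ∀ k → l ≺ k → ¬ ¬ (hasse j (coeff f) k ≈ 0#)
      above-l k l≺k =
        ¬¬-map (λ fk+j≈0 → trans (hasse-coeff j k (coeff f)) (·-zeroʳ (binomialProduct k j) fk+j≈0))
        (above-leading {f} leading (subst (_≺ zipWith ℕ._+_ k j) l+j≡i (compatible l k j l≺k)))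

theorem6p9 : ∀ {c ℓ : Level} (F : Field c ℓ) (n : ℕ) (f : FieldDefs.Poly F n)
    → (∃ λ i' → ¬ (Field._≈_ F (FieldDefs.coeff f i') (Field.0# F)))
    → (O : MonomialOrder n) (i : Exp n)
    → FieldDefs.IsLeadingMonomial F O f i
    → FieldDefs._≤dimPartials_ F (2 ^ support i) f
theorem6p9 F n f _ O i leading =
  derivatives , triangular⇒linearlyIndependent (2 ^ support i) _ l (coordinateSplit-injective i) leads
  where
  open Field F hiding (refl)
  open FieldDefs F
  open MonomialOrder O using (isStrictTotal)
  open LeadingExponents F isStrictTotal

  l j : Fin (2 ^ support i) → Exp n
  l = proj₁ ∘ coordinateSplit i
  j = proj₂ ∘ coordinateSplit i

  derivatives : Fin (2 ^ support i) → List.List (Carrier × Exp n)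
  derivatives r = (1# , j r) List.∷ List.[]

  leads : ∀ r → LeadsAt (combo (coeff f) (derivatives r)) (l r)
  leads r =
    LeadsAt-resp (λ ¬≈ → ¬≈ λ k → trans (+-identityʳ _) (*-identityˡ (hasse (j r) (coeff f) k)))
      (hasse-leadsAt F O {f} (l r) (j r) leading (coordinateSplit-sum i r) (coordinateSplit-binomialProduct i r))
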